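{- Let $G$ be a connected finite simple graph of order $2n$ with a perfect matching. Then $$F(G)\leq \begin{cases}\frac{e(G)-n}{2}, & \text{if } e(G)\geq 3n-2,\\ e(G)-2n+1, & \text{otherwise}.\end{cases}$$
   Context: For a graph $G$ with a perfect matching $M$, a subset $S\subseteq M$ is a forcing set of $M$ if $S$ is contained in no perfect matching of $G$ other than $M$. $f(G,M)$ is the minimum size of a forcing set of $M$, and the maximum forcing number is $F(G)=\max_M f(G,M)$ over all perfect matchings $M$ of $G$. $e(G)$ is the number of edges. -}

module Defs where

open import Data.Nat using (ℕ; zero; suc; _+_; _*_; _≤_; _<_)
open import Data.Fin using (Fin; toℕ)
open import Data.Bool using (Bool; true; false)
open import Data.List using (List; length; filter; allFin; concatMap)
open import Data.Product using (Σ; _×_; _,_; ∃; ∃-syntax)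
open import Relation.Binary.PropositionalEquality using (_≡_)
open import Relation.Nullary using (¬_; Dec; yes; no)
open import Relation.Nullary.Decidable using (_×-dec_)
open import Data.Fin using (_<?_)
open import Data.Bool using (_≟_)

record Graph (v : ℕ) : Set where
  field
    adj    : Fin v → Fin v → Bool
    sym    : ∀ i j → adj i j ≡ adj j i
    irrefl : ∀ i → adj i i ≡ false
open Graph public

-- A "Boolean edge set" (symmetric relation) on Fin v.
Rel₂ : ℕ → Set
Rel₂ v = Fin v → Fin v → Bool

pairs : (v : ℕ) → List (Fin v × Fin v)
pairs v = concatMap (λ i → Data.List.map (λ j → (i , j)) (allFin v)) (allFin v)
  where import Data.List

count : ∀ {v} → Rel₂ v → ℕ
count {v} R = length (filter (λ p → (Data.Product.proj₁ p <? Data.Product.proj₂ p)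
                                      ×-dec (R (Data.Product.proj₁ p) (Data.Product.proj₂ p) ≟ true))
                             (pairs v))
  where import Data.Product

e : ∀ {v} → Graph v → ℕ
e G = count (adj G)

data Reach {v} (G : Graph v) : Fin v → Fin v → Set where
  here : ∀ {i} → Reach G i i
  step : ∀ {i j k} → adj G i j ≡ true → Reach G j k → Reach G i k

Connected : ∀ {v} → Graph v → Set
Connected {v} G = ∀ (i j : Fin v) → Reach G i j

_⊆ᴱ_ : ∀ {v} → Rel₂ v → Rel₂ v → Set
S ⊆ᴱ R = ∀ i j → S i j ≡ true → R i j ≡ true

record IsPerfectMatching {v} (G : Graph v) (M : Rel₂ v) : Set where
  field
    sub    : M ⊆ᴱ adj G
    msym   : ∀ i j → M i j ≡ M j i
    cover  : ∀ i → ∃[ j ] (M i j ≡ true)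
    unique : ∀ i j k → M i j ≡ true → M i k ≡ true → j ≡ k

HasPerfectMatching : ∀ {v} → Graph v → Set
HasPerfectMatching G = ∃[ M ] IsPerfectMatching G M

record IsForcingSet {v} (G : Graph v) (M S : Rel₂ v) : Set where
  field
    ssym   : ∀ i j → S i j ≡ S j i
    ⊆M     : S ⊆ᴱ M
    forces : ∀ M′ → IsPerfectMatching G M′ → S ⊆ᴱ M′ → ∀ i j → M′ i j ≡ M i j

-- f(G,M) ≤ b : M has a forcing set of size at most b
-- (the minimum f(G,M) exists since M itself is a forcing set).
ForcingNumberAtMost : ∀ {v} → Graph v → Rel₂ v → ℕ → Set
ForcingNumberAtMost G M b = ∃[ S ] (IsForcingSet G M S × count S ≤ b)

MaxForcingNumberAtMost : ∀ {v} → Graph v → ℕ → Set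
MaxForcingNumberAtMost G b = ∀ M → IsPerfectMatching G M → ForcingNumberAtMost G M b

module Submission where

-- Fix a perfect matching M and grow a vertex set T, one M-edge {a, a′} at a time, where a is
-- adjacent to T (G is connected), together with a set S ⊆ M forcing M on T: every perfect
-- matching containing S that maps T into itself agrees with M on T. If a and a′ have distinct
-- neighbours c ≠ d in T, the edge aa′ is put into S, and G[T] gains the three edges aa′, ac, a′d.
-- Otherwise S already forces aa′ (a perfect matching avoiding aa′ would match a and a′ to
-- distinct vertices of T), and G[T] gains aa′ and the edge joining a to T. So the invariants
-- |S| + |T| ≤ e(G[T]) + 1 and 2|S| + 2 ≤ |T| survive every step, and for T = V(G) they give
-- f(G,M) ≤ e(G) − 2n + 1 and f(G,M) ≤ n − 1 for every perfect matching M.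

open import Defs hiding (sym)
open import Data.Nat using (ℕ; _+_; _*_; _≤_; _<_)
open import Data.Product using (∃-syntax; _×_)
open import Data.Fin using (Fin)

open import Data.Bool using (Bool; true; false; _∧_; _∨_) renaming (_≟_ to _≟ᵇ_)
open import Data.Bool.Properties
  using (∨-comm; ∨-zeroʳ; ∧-zeroʳ; ∧-comm; ∧-distribˡ-∨; ∧-conicalˡ; ∧-conicalʳ; ¬-not)
open import Data.Empty using (⊥-elim)
open import Data.Fin using (zero; suc; _<?_) renaming (_<_ to _<ᶠ_)
open import Data.Fin.Properties using (_≟_; <-cmp; <-asym; any?)
open import Data.List using (List; []; _∷_; _++_; map; concatMap; allFin; length; filter)
open import Data.List.Properties using (map-tabulate; length-tabulate)
open import Data.Nat using (zero; suc; z≤n; s≤s)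
open import Data.Nat.Properties
  using ( ≤-refl; ≤-trans; ≤-reflexive; module ≤-Reasoning; <⇒≱; n≤1+n; m≤m+n; m≤n+m; m<m+n
        ; +-assoc; +-identityʳ; +-commutativeSemigroup; *-distribˡ-+; *-distribʳ-+
        ; +-monoˡ-≤; +-monoʳ-≤; +-mono-≤; *-monoʳ-≤; +-cancelʳ-≤; *-cancelˡ-≤ )
open import Data.Nat.Tactic.RingSolver using (solve-∀)
open import Algebra.Properties.CommutativeSemigroup +-commutativeSemigroup
  using (interchange; xy∙z≈xz∙y)
open import Data.Product using (Σ; _,_; proj₁; proj₂)
open import Data.Sum using (_⊎_; inj₁; inj₂)
open import Function using (_∘_)
open import Level using (0ℓ)
open import Relation.Binary.Definitions using (tri<; tri≈; tri>)
open import Relation.Binary.PropositionalEquality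
  using (_≡_; _≢_; ≢-sym; refl; sym; trans; cong; cong₂; subst; subst₂; module ≡-Reasoning)
open import Relation.Nullary using (¬_; ¬?; Dec; does; yes; no)
open import Relation.Nullary.Decidable using (dec-true; dec-false; _×-dec_)
open import Relation.Unary using (Pred; Decidable)

-- Counting Boolean predicates

∨-true⁻ : ∀ a {b} → a ∨ b ≡ true → a ≡ true ⊎ b ≡ true
∨-true⁻ true  _ = inj₁ refl
∨-true⁻ false e = inj₂ e

∨-true⁺ʳ : ∀ a {b} → b ≡ true → a ∨ b ≡ true
∨-true⁺ʳ a refl = ∨-zeroʳ a

bool-ext : {a b : Bool} → (a ≡ true → b ≡ true) → (b ≡ true → a ≡ true) → a ≡ b
bool-ext {false} {false} _   _   = refl
bool-ext {false} {true}  _   b⇒a = b⇒a refl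
bool-ext {true}          a⇒b _   = sym (a⇒b refl)

does-true⁻ : {A : Set} {a? : Dec A} → does a? ≡ true → A
does-true⁻ {a? = yes a} _ = a

∈-∉-≢ : {A : Set} (T : A → Bool) {x y : A} → T x ≡ true → T y ≡ false → x ≢ y
∈-∉-≢ T x∈T y∉T refl with () ← trans (sym x∈T) y∉T

infixr 6 _∩_
infixr 5 _∪_

∅ : {A : Set} → A → Bool
∅ _ = false

_∪_ _∩_ : {A : Set} → (A → Bool) → (A → Bool) → A → Bool
(f ∪ g) x = f x ∨ g x
(f ∩ g) x = f x ∧ g x

_⊆_ : {A : Set} → (A → Bool) → (A → Bool) → Set
f ⊆ g = ∀ x → f x ≡ true → g x ≡ true

Disjoint : {A : Set} → (A → Bool) → (A → Bool) → Set
Disjoint f g = ∀ x → f x ≡ true → g x ≡ false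

boolToℕ : Bool → ℕ
boolToℕ true  = 1
boolToℕ false = 0

countᵇ : {A : Set} → (A → Bool) → List A → ℕ
countᵇ f []       = 0
countᵇ f (x ∷ xs) = boolToℕ (f x) + countᵇ f xs

module _ {A : Set} {f g : A → Bool} where

  countᵇ-cong : (∀ x → f x ≡ g x) → ∀ xs → countᵇ f xs ≡ countᵇ g xs
  countᵇ-cong f≗g []       = refl
  countᵇ-cong f≗g (x ∷ xs) = cong₂ _+_ (cong boolToℕ (f≗g x)) (countᵇ-cong f≗g xs)

  countᵇ-mono : f ⊆ g → ∀ xs → countᵇ f xs ≤ countᵇ g xs
  countᵇ-mono f⊆g []       = z≤n
  countᵇ-mono f⊆g (x ∷ xs) with f x in fx | g x in gx
  ... | true  | true  = s≤s (countᵇ-mono f⊆g xs)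
  ... | true  | false with () ← trans (sym (f⊆g x fx)) gx
  ... | false | _     = ≤-trans (countᵇ-mono f⊆g xs) (m≤n+m _ _)

  countᵇ-∪-∩ : ∀ xs → countᵇ (f ∪ g) xs + countᵇ (f ∩ g) xs ≡ countᵇ f xs + countᵇ g xs
  countᵇ-∪-∩ []       = refl
  countᵇ-∪-∩ (x ∷ xs) = begin
      (boolToℕ (f x ∨ g x) + countᵇ (f ∪ g) xs) + (boolToℕ (f x ∧ g x) + countᵇ (f ∩ g) xs)
    ≡⟨ interchange (boolToℕ (f x ∨ g x)) _ _ _ ⟩
      (boolToℕ (f x ∨ g x) + boolToℕ (f x ∧ g x)) + (countᵇ (f ∪ g) xs + countᵇ (f ∩ g) xs)
    ≡⟨ cong₂ _+_ (pointwise (f x) (g x)) (countᵇ-∪-∩ xs) ⟩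
      (boolToℕ (f x) + boolToℕ (g x)) + (countᵇ f xs + countᵇ g xs)
    ≡⟨ interchange (boolToℕ (f x)) _ _ _ ⟩
      (boolToℕ (f x) + countᵇ f xs) + (boolToℕ (g x) + countᵇ g xs)
    ∎
    where
    open ≡-Reasoning
    pointwise : ∀ a b → boolToℕ (a ∨ b) + boolToℕ (a ∧ b) ≡ boolToℕ a + boolToℕ b
    pointwise true  true  = refl
    pointwise true  false = refl
    pointwise false b     = +-identityʳ (boolToℕ b)

  countᵇ-∪-≤ : ∀ xs → countᵇ (f ∪ g) xs ≤ countᵇ f xs + countᵇ g xs
  countᵇ-∪-≤ xs = ≤-trans (m≤m+n _ _) (≤-reflexive (countᵇ-∪-∩ xs))

countᵇ-false : {A : Set} {f : A → Bool} → (∀ x → f x ≡ false) → ∀ xs → countᵇ f xs ≡ 0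
countᵇ-false f≡false []       = refl
countᵇ-false f≡false (x ∷ xs) rewrite f≡false x = countᵇ-false f≡false xs

countᵇ-∪-disjoint : {A : Set} {f g : A → Bool} → Disjoint f g →
  ∀ xs → countᵇ (f ∪ g) xs ≡ countᵇ f xs + countᵇ g xs
countᵇ-∪-disjoint {f = f} {g} f#g xs = begin
  countᵇ (f ∪ g) xs                       ≡⟨ sym (+-identityʳ _) ⟩
  countᵇ (f ∪ g) xs + 0                   ≡⟨ cong (countᵇ (f ∪ g) xs +_) (sym (countᵇ-false f∩g≡false xs)) ⟩
  countᵇ (f ∪ g) xs + countᵇ (f ∩ g) xs   ≡⟨ countᵇ-∪-∩ xs ⟩
  countᵇ f xs + countᵇ g xs               ∎
  where
  open ≡-Reasoning
  f∩g≡false : ∀ x → (f ∩ g) x ≡ false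
  f∩g≡false x with f x in fx
  ... | true  = f#g x fx
  ... | false = refl

countᵇ-true : {A : Set} (xs : List A) → countᵇ (λ _ → true) xs ≡ length xs
countᵇ-true []       = refl
countᵇ-true (x ∷ xs) = cong suc (countᵇ-true xs)

countᵇ-++ : {A : Set} (f : A → Bool) (xs ys : List A) → countᵇ f (xs ++ ys) ≡ countᵇ f xs + countᵇ f ys
countᵇ-++ f []       ys = refl
countᵇ-++ f (x ∷ xs) ys =
  trans (cong (boolToℕ (f x) +_) (countᵇ-++ f xs ys)) (sym (+-assoc (boolToℕ (f x)) _ _))

countᵇ-map : {A B : Set} (f : B → Bool) (h : A → B) (xs : List A) →
  countᵇ f (map h xs) ≡ countᵇ (f ∘ h) xs
countᵇ-map f h []       = refl
countᵇ-map f h (x ∷ xs) = cong (boolToℕ (f (h x)) +_) (countᵇ-map f h xs)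

countᵇ-cartesian : {A B : Set} (f : A → Bool) (g : B → Bool) (xs : List A) (ys : List B) →
  countᵇ (λ p → f (proj₁ p) ∧ g (proj₂ p)) (concatMap (λ x → map (x ,_) ys) xs)
    ≡ countᵇ f xs * countᵇ g ys
countᵇ-cartesian f g []       ys = refl
countᵇ-cartesian f g (x ∷ xs) ys = begin
    countᵇ fg (map (x ,_) ys ++ concatMap (λ x → map (x ,_) ys) xs)
  ≡⟨ countᵇ-++ fg (map (x ,_) ys) _ ⟩
    countᵇ fg (map (x ,_) ys) + countᵇ fg (concatMap (λ x → map (x ,_) ys) xs)
  ≡⟨ cong₂ _+_ (trans (countᵇ-map fg (x ,_) ys) (row (f x))) (countᵇ-cartesian f g xs ys) ⟩
    boolToℕ (f x) * countᵇ g ys + countᵇ f xs * countᵇ g ys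
  ≡⟨ sym (*-distribʳ-+ (countᵇ g ys) (boolToℕ (f x)) _) ⟩
    (boolToℕ (f x) + countᵇ f xs) * countᵇ g ys
  ∎
  where
  open ≡-Reasoning
  fg = λ p → f (proj₁ p) ∧ g (proj₂ p)
  row : ∀ b → countᵇ (λ y → b ∧ g y) ys ≡ boolToℕ b * countᵇ g ys
  row true  = sym (+-identityʳ _)
  row false = countᵇ-false (λ _ → refl) ys

countᵇ-allFin-suc : ∀ {n} (f : Fin (suc n) → Bool) →
  countᵇ f (allFin (suc n)) ≡ boolToℕ (f zero) + countᵇ (f ∘ suc) (allFin n)
countᵇ-allFin-suc {n} f = cong (boolToℕ (f zero) +_)
  (trans (cong (countᵇ f) (sym (map-tabulate (λ i → i) suc))) (countᵇ-map f suc (allFin n)))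

length-filter≡countᵇ : {A : Set} {P : Pred A 0ℓ} (P? : Decidable P) (xs : List A) →
  length (filter P? xs) ≡ countᵇ (does ∘ P?) xs
length-filter≡countᵇ P? []       = refl
length-filter≡countᵇ P? (x ∷ xs) with does (P? x)
... | true  = cong suc (length-filter≡countᵇ P? xs)
... | false = length-filter≡countᵇ P? xs

⁅_⁆ : ∀ {n} → Fin n → Fin n → Bool
⁅ y ⁆ x = does (x ≟ y)

∈⁅⁆⁻ : ∀ {n} {x y : Fin n} → ⁅ y ⁆ x ≡ true → x ≡ y
∈⁅⁆⁻ {x = x} {y} = does-true⁻ {a? = x ≟ y}

⁅⁆-refl : ∀ {n} (y : Fin n) → ⁅ y ⁆ y ≡ true
⁅⁆-refl y = dec-true (y ≟ y) refl

countᵇ-⁅⁆ : ∀ {n} (y : Fin n) → countᵇ ⁅ y ⁆ (allFin n) ≡ 1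
countᵇ-⁅⁆ {suc n} zero    =
  trans (countᵇ-allFin-suc {n} ⁅ zero ⁆) (cong suc (countᵇ-false (λ _ → refl) (allFin n)))
countᵇ-⁅⁆ {suc n} (suc y) = trans (countᵇ-allFin-suc {n} ⁅ suc y ⁆) (countᵇ-⁅⁆ y)

-- Edge sets

module _ {v : ℕ} where

  infixl 5 _∪ᴱ_

  ∅ᴱ : Rel₂ v
  ∅ᴱ _ _ = false

  _∪ᴱ_ : Rel₂ v → Rel₂ v → Rel₂ v
  (R ∪ᴱ Q) i = R i ∪ Q i

  Symmetricᴱ : Rel₂ v → Set
  Symmetricᴱ R = ∀ i j → R i j ≡ R j i

  ∪ᴱ-sym : {R Q : Rel₂ v} → Symmetricᴱ R → Symmetricᴱ Q → Symmetricᴱ (R ∪ᴱ Q)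
  ∪ᴱ-sym R-sym Q-sym i j = cong₂ _∨_ (R-sym i j) (Q-sym i j)

  ∪ᴱ-⊆ : {R Q U : Rel₂ v} → R ⊆ᴱ U → Q ⊆ᴱ U → (R ∪ᴱ Q) ⊆ᴱ U
  ∪ᴱ-⊆ {R} R⊆U Q⊆U i j e with ∨-true⁻ (R i j) e
  ... | inj₁ ij∈R = R⊆U i j ij∈R
  ... | inj₂ ij∈Q = Q⊆U i j ij∈Q

  ⊆-∪ᴱˡ : (R Q : Rel₂ v) → R ⊆ᴱ (R ∪ᴱ Q)
  ⊆-∪ᴱˡ R Q i j ij∈R rewrite ij∈R = refl

  ⊆-∪ᴱʳ : (R Q : Rel₂ v) → Q ⊆ᴱ (R ∪ᴱ Q)
  ⊆-∪ᴱʳ R Q i j = ∨-true⁺ʳ (R i j)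

  ∉-∪ᴱ : (R Q : Rel₂ v) {i j : Fin v} → ¬ R i j ≡ true → ¬ Q i j ≡ true → ¬ (R ∪ᴱ Q) i j ≡ true
  ∉-∪ᴱ R Q {i} {j} ij∉R ij∉Q e with ∨-true⁻ (R i j) e
  ... | inj₁ ij∈R = ij∉R ij∈R
  ... | inj₂ ij∈Q = ij∉Q ij∈Q

  ordered : Rel₂ v → Fin v × Fin v → Bool
  ordered R (i , j) = does (i <? j) ∧ R i j

  count≡countᵇ : (R : Rel₂ v) → count R ≡ countᵇ (ordered R) (pairs v)
  count≡countᵇ R = trans (length-filter≡countᵇ _ (pairs v)) (countᵇ-cong same (pairs v))
    where
    same : ∀ p → does ((proj₁ p <? proj₂ p) ×-dec (R (proj₁ p) (proj₂ p) ≟ᵇ true)) ≡ ordered R p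
    same (i , j) with R i j
    ... | true  = refl
    ... | false = refl

  count-cong : {R Q : Rel₂ v} → (∀ i j → R i j ≡ Q i j) → count R ≡ count Q
  count-cong {R} {Q} R≗Q = begin
    count R                      ≡⟨ count≡countᵇ R ⟩
    countᵇ (ordered R) (pairs v) ≡⟨ countᵇ-cong (λ (i , j) → cong (does (i <? j) ∧_) (R≗Q i j)) (pairs v) ⟩
    countᵇ (ordered Q) (pairs v) ≡⟨ sym (count≡countᵇ Q) ⟩
    count Q                      ∎
    where open ≡-Reasoning

  count-mono : {R Q : Rel₂ v} → R ⊆ᴱ Q → count R ≤ count Q
  count-mono {R} {Q} R⊆Q = subst₂ _≤_ (sym (count≡countᵇ R)) (sym (count≡countᵇ Q))
    (countᵇ-mono ordered-mono (pairs v))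
    where
    ordered-mono : ordered R ⊆ ordered Q
    ordered-mono (i , j) e rewrite ∧-conicalˡ (does (i <? j)) (R i j) e = R⊆Q i j (∧-conicalʳ _ _ e)

  count-∅ᴱ : count ∅ᴱ ≡ 0
  count-∅ᴱ = trans (count≡countᵇ ∅ᴱ) (countᵇ-false (λ (i , j) → ∧-zeroʳ (does (i <? j))) (pairs v))

  count-+-count≡countᵇ : (R Q : Rel₂ v) →
    count R + count Q ≡ countᵇ (ordered R) (pairs v) + countᵇ (ordered Q) (pairs v)
  count-+-count≡countᵇ R Q = cong₂ _+_ (count≡countᵇ R) (count≡countᵇ Q)

  count-∪ᴱ≡countᵇ : (R Q : Rel₂ v) → count (R ∪ᴱ Q) ≡ countᵇ (ordered R ∪ ordered Q) (pairs v)
  count-∪ᴱ≡countᵇ R Q = trans (count≡countᵇ (R ∪ᴱ Q))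
    (countᵇ-cong (λ (i , j) → ∧-distribˡ-∨ (does (i <? j)) (R i j) (Q i j)) (pairs v))

  count-∪-≤ : (R Q : Rel₂ v) → count (R ∪ᴱ Q) ≤ count R + count Q
  count-∪-≤ R Q = begin
    count (R ∪ᴱ Q)                                              ≡⟨ count-∪ᴱ≡countᵇ R Q ⟩
    countᵇ (ordered R ∪ ordered Q) (pairs v)                    ≤⟨ countᵇ-∪-≤ (pairs v) ⟩
    countᵇ (ordered R) (pairs v) + countᵇ (ordered Q) (pairs v) ≡⟨ sym (count-+-count≡countᵇ R Q) ⟩
    count R + count Q                                           ∎
    where open ≤-Reasoning

  count-∪-disjoint : {R Q : Rel₂ v} → (∀ i j → R i j ≡ true → Q i j ≡ false) →
    count (R ∪ᴱ Q) ≡ count R + count Q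
  count-∪-disjoint {R} {Q} R#Q = begin
    count (R ∪ᴱ Q)                                              ≡⟨ count-∪ᴱ≡countᵇ R Q ⟩
    countᵇ (ordered R ∪ ordered Q) (pairs v)                    ≡⟨ countᵇ-∪-disjoint R#Q′ (pairs v) ⟩
    countᵇ (ordered R) (pairs v) + countᵇ (ordered Q) (pairs v) ≡⟨ sym (count-+-count≡countᵇ R Q) ⟩
    count R + count Q                                           ∎
    where
    open ≡-Reasoning
    R#Q′ : Disjoint (ordered R) (ordered Q)
    R#Q′ (i , j) e rewrite ∧-conicalˡ (does (i <? j)) (R i j) e = R#Q i j (∧-conicalʳ _ _ e)

  edge : Fin v → Fin v → Rel₂ v
  edge x y i j = (⁅ x ⁆ i ∧ ⁅ y ⁆ j) ∨ (⁅ y ⁆ i ∧ ⁅ x ⁆ j)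

  edge-endpoints : ∀ {x y i j} → edge x y i j ≡ true → (i ≡ x × j ≡ y) ⊎ (i ≡ y × j ≡ x)
  edge-endpoints {x} {y} {i} {j} e with ∨-true⁻ (⁅ x ⁆ i ∧ ⁅ y ⁆ j) e
  ... | inj₁ ij≡xy = inj₁ (∈⁅⁆⁻ (∧-conicalˡ (⁅ x ⁆ i) _ ij≡xy) ,
                          ∈⁅⁆⁻ (∧-conicalʳ (⁅ x ⁆ i) _ ij≡xy))
  ... | inj₂ ij≡yx = inj₂ (∈⁅⁆⁻ (∧-conicalˡ (⁅ y ⁆ i) _ ij≡yx) ,
                          ∈⁅⁆⁻ (∧-conicalʳ (⁅ y ⁆ i) _ ij≡yx))

  edge-refl : ∀ x y → edge x y x y ≡ true
  edge-refl x y rewrite ⁅⁆-refl x | ⁅⁆-refl y = refl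

  edge-comm : ∀ x y i j → edge x y i j ≡ edge y x i j
  edge-comm x y i j = ∨-comm (⁅ x ⁆ i ∧ ⁅ y ⁆ j) _

  edge-sym : ∀ x y → Symmetricᴱ (edge x y)
  edge-sym x y i j = trans (∨-comm (⁅ x ⁆ i ∧ ⁅ y ⁆ j) _)
    (cong₂ _∨_ (∧-comm (⁅ y ⁆ i) (⁅ x ⁆ j)) (∧-comm (⁅ x ⁆ i) (⁅ y ⁆ j)))

  edge-∉ˡ : ∀ {x y i} j → i ≢ x → i ≢ y → ¬ edge x y i j ≡ true
  edge-∉ˡ {x} {y} {i} j i≢x i≢y e with edge-endpoints {x} {y} {i} {j} e
  ... | inj₁ (i≡x , _) = i≢x i≡x
  ... | inj₂ (i≡y , _) = i≢y i≡y

  edge-∉ʳ : ∀ {x y} i {j} → j ≢ x → j ≢ y → ¬ edge x y i j ≡ true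
  edge-∉ʳ {x} {y} i {j} j≢x j≢y e with edge-endpoints {x} {y} {i} {j} e
  ... | inj₁ (_ , j≡y) = j≢y j≡y
  ... | inj₂ (_ , j≡x) = j≢x j≡x

  count-edge< : ∀ {x y} → x <ᶠ y → count (edge x y) ≡ 1
  count-edge< {x} {y} x<y = begin
    count (edge x y)
      ≡⟨ count≡countᵇ (edge x y) ⟩
    countᵇ (ordered (edge x y)) (pairs v)
      ≡⟨ countᵇ-cong only-xy (pairs v) ⟩
    countᵇ (λ p → ⁅ x ⁆ (proj₁ p) ∧ ⁅ y ⁆ (proj₂ p)) (pairs v)
      ≡⟨ countᵇ-cartesian ⁅ x ⁆ ⁅ y ⁆ (allFin v) (allFin v) ⟩
    countᵇ ⁅ x ⁆ (allFin v) * countᵇ ⁅ y ⁆ (allFin v)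
      ≡⟨ cong₂ _*_ (countᵇ-⁅⁆ x) (countᵇ-⁅⁆ y) ⟩
    1 ∎
    where
    open ≡-Reasoning
    only-xy : ∀ p → ordered (edge x y) p ≡ ⁅ x ⁆ (proj₁ p) ∧ ⁅ y ⁆ (proj₂ p)
    only-xy (i , j) = bool-ext to from
      where
      to : ordered (edge x y) (i , j) ≡ true → ⁅ x ⁆ i ∧ ⁅ y ⁆ j ≡ true
      to e with edge-endpoints {x} {y} {i} {j} (∧-conicalʳ (does (i <? j)) _ e)
      ... | inj₁ (refl , refl) rewrite ⁅⁆-refl x | ⁅⁆-refl y = refl
      ... | inj₂ (refl , refl) = ⊥-elim (<-asym x<y (does-true⁻ {a? = y <? x} (∧-conicalˡ _ (edge x y y x) e)))
      from : ⁅ x ⁆ i ∧ ⁅ y ⁆ j ≡ true → ordered (edge x y) (i , j) ≡ true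
      from e rewrite ∈⁅⁆⁻ {x = i} (∧-conicalˡ (⁅ x ⁆ i) _ e)
                   | ∈⁅⁆⁻ {x = j} (∧-conicalʳ (⁅ x ⁆ i) _ e)
                   | dec-true (x <? y) x<y
                   = edge-refl x y

  count-edge : ∀ {x y} → x ≢ y → count (edge x y) ≡ 1
  count-edge {x} {y} x≢y with <-cmp x y
  ... | tri< x<y _ _ = count-edge< x<y
  ... | tri≈ _ x≡y _ = ⊥-elim (x≢y x≡y)
  ... | tri> _ _ y<x = trans (count-cong (edge-comm x y)) (count-edge< y<x)

  count-∪-edge : (R : Rel₂ v) {u w : Fin v} → u ≢ w → Symmetricᴱ R → ¬ R u w ≡ true →
    count (R ∪ᴱ edge u w) ≡ count R + 1
  count-∪-edge R {u} {w} u≢w R-sym uw∉R =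
    trans (count-∪-disjoint R#uw) (cong (count R +_) (count-edge u≢w))
    where
    R#uw : ∀ i j → R i j ≡ true → edge u w i j ≡ false
    R#uw i j ij∈R with edge u w i j in ij∈uw
    ... | false = refl
    ... | true with edge-endpoints {u} {w} {i} {j} ij∈uw
    ...   | inj₁ (refl , refl) = ⊥-elim (uw∉R ij∈R)
    ...   | inj₂ (refl , refl) = ⊥-elim (uw∉R (trans (R-sym u w) ij∈R))

-- Vertex sets

module _ {v : ℕ} where

  size : (Fin v → Bool) → ℕ
  size T = countᵇ T (allFin v)

  size-≤ : (T : Fin v → Bool) → size T ≤ v
  size-≤ T = begin
    countᵇ T (allFin v)              ≤⟨ countᵇ-mono (λ _ _ → refl) (allFin v) ⟩
    countᵇ (λ _ → true) (allFin v)   ≡⟨ countᵇ-true (allFin v) ⟩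
    length (allFin v)                ≡⟨ length-tabulate (λ i → i) ⟩
    v                                ∎
    where open ≤-Reasoning

  size-full : {T : Fin v → Bool} → (∀ x → T x ≡ true) → size T ≡ v
  size-full {T} T-full =
    trans (countᵇ-cong T-full (allFin v)) (trans (countᵇ-true (allFin v)) (length-tabulate (λ i → i)))

  ⁅⁆-disjoint : {T : Fin v → Bool} {y : Fin v} → T y ≡ false → Disjoint T ⁅ y ⁆
  ⁅⁆-disjoint {T} {y} y∉T x x∈T = dec-false (x ≟ y) (∈-∉-≢ T x∈T y∉T)

  size-missing : {T : Fin v → Bool} {y : Fin v} → T y ≡ false → size T < v
  size-missing {T} {y} y∉T = begin-strict
    size T                   <⟨ m<m+n (size T) (s≤s z≤n) ⟩
    size T + 1               ≡⟨ cong (size T +_) (sym (countᵇ-⁅⁆ y)) ⟩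
    size T + size ⁅ y ⁆      ≡⟨ sym (countᵇ-∪-disjoint (⁅⁆-disjoint y∉T) (allFin v)) ⟩
    size (T ∪ ⁅ y ⁆)         ≤⟨ size-≤ (T ∪ ⁅ y ⁆) ⟩
    v                        ∎
    where open ≤-Reasoning

  size-∪-doubleton : {T : Fin v → Bool} {a b : Fin v} → a ≢ b → T a ≡ false → T b ≡ false →
    size (T ∪ ⁅ a ⁆ ∪ ⁅ b ⁆) ≡ size T + 2
  size-∪-doubleton {T} {a} {b} a≢b a∉T b∉T = begin
    size (T ∪ ⁅ a ⁆ ∪ ⁅ b ⁆)             ≡⟨ countᵇ-∪-disjoint T#ab (allFin v) ⟩
    size T + size (⁅ a ⁆ ∪ ⁅ b ⁆)        ≡⟨ cong (size T +_) (countᵇ-∪-disjoint a#b (allFin v)) ⟩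
    size T + (size ⁅ a ⁆ + size ⁅ b ⁆)   ≡⟨ cong₂ (λ m n → size T + (m + n)) (countᵇ-⁅⁆ a) (countᵇ-⁅⁆ b) ⟩
    size T + 2                           ∎
    where
    open ≡-Reasoning
    T#ab : Disjoint T (⁅ a ⁆ ∪ ⁅ b ⁆)
    T#ab x x∈T = cong₂ _∨_ (⁅⁆-disjoint a∉T x x∈T) (⁅⁆-disjoint b∉T x x∈T)
    a#b : Disjoint ⁅ a ⁆ ⁅ b ⁆
    a#b = ⁅⁆-disjoint (dec-false (b ≟ a) (≢-sym a≢b))

  ∪-doubleton⁻ : ∀ T {a b x : Fin v} → (T ∪ ⁅ a ⁆ ∪ ⁅ b ⁆) x ≡ true → T x ≡ true ⊎ x ≡ a ⊎ x ≡ b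
  ∪-doubleton⁻ T {a} {x = x} e with ∨-true⁻ (T x) e
  ... | inj₁ x∈T  = inj₁ x∈T
  ... | inj₂ x∈ab with ∨-true⁻ (⁅ a ⁆ x) x∈ab
  ...   | inj₁ x≡a = inj₂ (inj₁ (∈⁅⁆⁻ x≡a))
  ...   | inj₂ x≡b = inj₂ (inj₂ (∈⁅⁆⁻ x≡b))

  ∪-doubleton-∖ : ∀ T {a b x : Fin v} → (T ∪ ⁅ a ⁆ ∪ ⁅ b ⁆) x ≡ true → x ≢ a → x ≢ b → T x ≡ true
  ∪-doubleton-∖ T x∈T′ x≢a x≢b with ∪-doubleton⁻ T x∈T′
  ... | inj₁ x∈T         = x∈T
  ... | inj₂ (inj₁ x≡a) = ⊥-elim (x≢a x≡a)
  ... | inj₂ (inj₂ x≡b) = ⊥-elim (x≢b x≡b)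

  ∪-doubleton⁺ : ∀ T a b {x : Fin v} → T x ≡ true → (T ∪ ⁅ a ⁆ ∪ ⁅ b ⁆) x ≡ true
  ∪-doubleton⁺ T a b x∈T rewrite x∈T = refl

  ∪-doubleton-∋ˡ : ∀ T (a b : Fin v) → (T ∪ ⁅ a ⁆ ∪ ⁅ b ⁆) a ≡ true
  ∪-doubleton-∋ˡ T a b rewrite ⁅⁆-refl a = ∨-zeroʳ (T a)

  ∪-doubleton-∋ʳ : ∀ T (a b : Fin v) → (T ∪ ⁅ a ⁆ ∪ ⁅ b ⁆) b ≡ true
  ∪-doubleton-∋ʳ T a b rewrite ⁅⁆-refl b = trans (cong (T b ∨_) (∨-zeroʳ (⁅ a ⁆ b))) (∨-zeroʳ (T b))

-- Graphs and perfect matchings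

boundary-edge : ∀ {v} {G : Graph v} (T : Fin v → Bool) {x y : Fin v} →
  Reach G x y → T x ≡ true → T y ≡ false → ∃[ u ] ∃[ w ] (T u ≡ true × T w ≡ false × adj G u w ≡ true)
boundary-edge T here x∈T x∉T with () ← trans (sym x∈T) x∉T
boundary-edge T {x} (step {j = j} xj∈G j⇝y) x∈T y∉T with T j in j∈T
... | true  = boundary-edge T j⇝y j∈T y∉T
... | false = x , j , x∈T , j∈T , xj∈G

Closed : ∀ {v} → Rel₂ v → (Fin v → Bool) → Set
Closed N T = ∀ x y → T x ≡ true → N x y ≡ true → T y ≡ true

module Matching {v} {G : Graph v} {N : Rel₂ v} (pm : IsPerfectMatching G N) where
  open IsPerfectMatching pm public

  partner : Fin v → Fin v
  partner i = proj₁ (cover i)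

  partner-∈ : ∀ i → N i (partner i) ≡ true
  partner-∈ i = proj₂ (cover i)

  ∈-sym : ∀ {i j} → N i j ≡ true → N j i ≡ true
  ∈-sym {i} {j} e = trans (msym j i) e

  loopless : ∀ {i j} → N i j ≡ true → i ≢ j
  loopless {i} e refl with () ← trans (sym (sub i i e)) (irrefl G i)

  partner≢ : ∀ i → i ≢ partner i
  partner≢ i = loopless (partner-∈ i)

  row-agree : ∀ {N′ i j} → IsPerfectMatching G N′ → N i j ≡ true → N′ i j ≡ true → ∀ k → N i k ≡ N′ i k
  row-agree {N′} {i} {j} pm′ ij∈N ij∈N′ k = bool-ext
    (λ ik∈N → subst (λ l → N′ i l ≡ true) (unique i j k ij∈N ik∈N) ij∈N′)
    (λ ik∈N′ → subst (λ l → N i l ≡ true) (IsPerfectMatching.unique pm′ i j k ij∈N′ ik∈N′) ij∈N)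

  edge-⊆ : ∀ {x y} → N x y ≡ true → edge x y ⊆ᴱ N
  edge-⊆ {x} {y} xy∈N i j e with edge-endpoints {x = x} {y = y} {i = i} {j = j} e
  ... | inj₁ (refl , refl) = xy∈N
  ... | inj₂ (refl , refl) = ∈-sym xy∈N

  closed-∉ : ∀ {T x y} → Closed N T → N x y ≡ true → T x ≡ false → T y ≡ false
  closed-∉ {T} {x} {y} closed xy∈N x∉T with T y in y∈T
  ... | false = refl
  ... | true with () ← trans (sym (closed y x y∈T (∈-sym xy∈N))) x∉T

  closed-∪-doubleton : ∀ {T a b} → N a b ≡ true → Closed N T → Closed N (T ∪ ⁅ a ⁆ ∪ ⁅ b ⁆)
  closed-∪-doubleton {T} {a} {b} ab∈N closed x y x∈T′ xy∈N with ∪-doubleton⁻ T x∈T′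
  ... | inj₁ x∈T         = ∪-doubleton⁺ T a b (closed x y x∈T xy∈N)
  ... | inj₂ (inj₁ refl) = subst (λ z → (T ∪ ⁅ a ⁆ ∪ ⁅ b ⁆) z ≡ true)
                             (unique a b y ab∈N xy∈N) (∪-doubleton-∋ʳ T a b)
  ... | inj₂ (inj₂ refl) = subst (λ z → (T ∪ ⁅ a ⁆ ∪ ⁅ b ⁆) z ≡ true)
                             (unique b a y (∈-sym ab∈N) xy∈N) (∪-doubleton-∋ˡ T a b)

  closed-∖-doubleton : ∀ {T a b} → N a b ≡ true → T a ≡ false → T b ≡ false →
    Closed N (T ∪ ⁅ a ⁆ ∪ ⁅ b ⁆) → Closed N T
  closed-∖-doubleton {T} {a} {b} ab∈N a∉T b∉T closed x y x∈T xy∈N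
    with ∪-doubleton⁻ T (closed x y (∪-doubleton⁺ T a b x∈T) xy∈N)
  ... | inj₁ y∈T         = y∈T
  ... | inj₂ (inj₁ refl) = ⊥-elim (∈-∉-≢ T x∈T b∉T (unique a x b (∈-sym xy∈N) ab∈N))
  ... | inj₂ (inj₂ refl) = ⊥-elim (∈-∉-≢ T x∈T a∉T (unique b x a (∈-sym xy∈N) (∈-sym ab∈N)))

-- Arithmetic of the invariants

cyclomatic-step : ∀ {s s′ t e e′ k} →
  s′ ≤ s + k → s + t ≤ e + 1 → e + (k + 2) ≤ e′ → s′ + (t + 2) ≤ e′ + 1
cyclomatic-step {s} {s′} {t} {e} {e′} {k} s′≤ s+t≤ e≤ = begin
  s′ + (t + 2)         ≤⟨ +-monoˡ-≤ (t + 2) s′≤ ⟩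
  s + k + (t + 2)      ≡⟨ interchange s k t 2 ⟩
  s + t + (k + 2)      ≤⟨ +-monoˡ-≤ (k + 2) s+t≤ ⟩
  e + 1 + (k + 2)      ≡⟨ xy∙z≈xz∙y e 1 (k + 2) ⟩
  e + (k + 2) + 1      ≤⟨ +-monoˡ-≤ 1 e≤ ⟩
  e′ + 1               ∎
  where open ≤-Reasoning

matching-step : ∀ {s s′ t k} → s′ ≤ s + k → k ≤ 1 → 2 * s + 2 ≤ t → 2 * s′ + 2 ≤ t + 2
matching-step {s} {s′} {t} {k} s′≤ k≤1 2s+2≤t = begin
  2 * s′ + 2           ≤⟨ +-monoˡ-≤ 2 (*-monoʳ-≤ 2 s′≤) ⟩
  2 * (s + k) + 2      ≡⟨ cong (_+ 2) (*-distribˡ-+ 2 s k) ⟩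
  2 * s + 2 * k + 2    ≡⟨ xy∙z≈xz∙y (2 * s) (2 * k) 2 ⟩
  2 * s + 2 + 2 * k    ≤⟨ +-mono-≤ 2s+2≤t (*-monoʳ-≤ 2 k≤1) ⟩
  t + 2                ∎
  where open ≤-Reasoning

average-bound : ∀ {s n e} → s + 2 * n ≤ e + 1 → 2 * s + 2 ≤ 2 * n → 2 * s + n ≤ e
average-bound {s} {n} {e} cyclomatic matching = +-cancelʳ-≤ 1 _ _ (begin
  2 * s + n + 1        ≡⟨ regroupˡ s n ⟩
  s + (s + 1) + n      ≤⟨ +-monoˡ-≤ n (+-monoʳ-≤ s s+1≤n) ⟩
  s + n + n            ≡⟨ regroupʳ s n ⟩
  s + 2 * n            ≤⟨ cyclomatic ⟩
  e + 1                ∎)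
  where
  open ≤-Reasoning
  s+1≤n : s + 1 ≤ n
  s+1≤n = *-cancelˡ-≤ 2 (subst (_≤ 2 * n) (sym (*-distribˡ-+ 2 s 1)) matching)
  regroupˡ : ∀ s n → 2 * s + n + 1 ≡ s + (s + 1) + n
  regroupˡ = solve-∀
  regroupʳ : ∀ s n → s + n + n ≡ s + 2 * n
  regroupʳ = solve-∀

-- Growing a forcing set

module Growth {v} (G : Graph v) (M : Rel₂ v) (M-pm : IsPerfectMatching G M) where
  open Matching M-pm using (sub; ∈-sym; edge-⊆; closed-∉; closed-∪-doubleton)
    renaming (partner to mate; partner-∈ to M-mate; partner≢ to mate≢)

  pair : Fin v → Fin v → Bool
  pair a = ⁅ a ⁆ ∪ ⁅ mate a ⁆

  size-∪-pair : ∀ {T a} → Closed M T → T a ≡ false → size (T ∪ pair a) ≡ size T + 2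
  size-∪-pair {T} {a} T-closed a∉T = size-∪-doubleton (mate≢ a) a∉T (closed-∉ T-closed (M-mate a) a∉T)

  induced : (Fin v → Bool) → Rel₂ v
  induced T i j = T i ∧ T j ∧ adj G i j

  induced-sym : ∀ T → Symmetricᴱ (induced T)
  induced-sym T i j with T i | T j
  ... | true  | true  = Graph.sym G i j
  ... | true  | false = refl
  ... | false | true  = refl
  ... | false | false = refl

  induced-∉ : ∀ T {u} w → T u ≡ false → ¬ induced T u w ≡ true
  induced-∉ T {u} w u∉T e with () ← trans (sym (∧-conicalˡ (T u) _ e)) u∉T

  induced-⊆-adj : ∀ T → induced T ⊆ᴱ adj G
  induced-⊆-adj T i j e = ∧-conicalʳ (T j) _ (∧-conicalʳ (T i) _ e)

  induced-mono : ∀ {T U} → T ⊆ U → induced T ⊆ᴱ induced U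
  induced-mono {T} T⊆U i j e
    rewrite T⊆U i (∧-conicalˡ (T i) _ e) | T⊆U j (∧-conicalˡ (T j) _ (∧-conicalʳ (T i) _ e)) =
    induced-⊆-adj T i j e

  edge-⊆-induced : ∀ T {u w} → T u ≡ true → T w ≡ true → adj G u w ≡ true → edge u w ⊆ᴱ induced T
  edge-⊆-induced T {u} {w} u∈T w∈T uw∈G i j e with edge-endpoints {x = u} {y = w} {i = i} {j = j} e
  ... | inj₁ (refl , refl) rewrite u∈T | w∈T = uw∈G
  ... | inj₂ (refl , refl) rewrite u∈T | w∈T = trans (Graph.sym G w u) uw∈G

  module _ {T : Fin v → Bool} {a : Fin v} (a∉T : T a ≡ false) (a′∉T : T (mate a) ≡ false) where

    private
      a′ = mate a
      T′ = T ∪ pair a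

      T⊆T′ : T ⊆ T′
      T⊆T′ x = ∪-doubleton⁺ T a a′

      aa′⊆T′ : edge a a′ ⊆ᴱ induced T′
      aa′⊆T′ =
        edge-⊆-induced T′ (∪-doubleton-∋ˡ T a a′) (∪-doubleton-∋ʳ T a a′) (sub a a′ (M-mate a))

      edge-⊆-T′ : ∀ {u w} → T′ u ≡ true → T w ≡ true → adj G u w ≡ true → edge u w ⊆ᴱ induced T′
      edge-⊆-T′ u∈T′ w∈T = edge-⊆-induced T′ u∈T′ (T⊆T′ _ w∈T)

    count-two-new-edges : ∀ {c} → T c ≡ true →
      count (induced T ∪ᴱ edge a a′ ∪ᴱ edge a c) ≡ count (induced T) + 2
    count-two-new-edges {c} c∈T = begin
      count (induced T ∪ᴱ edge a a′ ∪ᴱ edge a c)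
        ≡⟨ count-∪-edge (induced T ∪ᴱ edge a a′) (≢-sym c≢a)
             (∪ᴱ-sym (induced-sym T) (edge-sym a a′)) ac∉R ⟩
      count (induced T ∪ᴱ edge a a′) + 1
        ≡⟨ cong (_+ 1) (count-∪-edge (induced T) (mate≢ a) (induced-sym T) (induced-∉ T a′ a∉T)) ⟩
      count (induced T) + 1 + 1
        ≡⟨ +-assoc (count (induced T)) 1 1 ⟩
      count (induced T) + 2
        ∎
      where
      open ≡-Reasoning
      c≢a = ∈-∉-≢ T c∈T a∉T
      ac∉R : ¬ (induced T ∪ᴱ edge a a′) a c ≡ true
      ac∉R = ∉-∪ᴱ (induced T) (edge a a′)
        (induced-∉ T c a∉T) (edge-∉ʳ a c≢a (∈-∉-≢ T c∈T a′∉T))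

    induced-gain₂ : ∀ {c} → T c ≡ true → adj G a c ≡ true → count (induced T) + 2 ≤ count (induced T′)
    induced-gain₂ {c} c∈T ac∈G = begin
      count (induced T) + 2                        ≡⟨ sym (count-two-new-edges c∈T) ⟩
      count (induced T ∪ᴱ edge a a′ ∪ᴱ edge a c)   ≤⟨ count-mono R⊆T′ ⟩
      count (induced T′)                           ∎
      where
      open ≤-Reasoning
      R⊆T′ = ∪ᴱ-⊆ (∪ᴱ-⊆ (induced-mono T⊆T′) aa′⊆T′)
                  (edge-⊆-T′ (∪-doubleton-∋ˡ T a a′) c∈T ac∈G)

    induced-gain₃ : ∀ {c d} → T c ≡ true → T d ≡ true → adj G a c ≡ true → adj G a′ d ≡ true →
      count (induced T) + 3 ≤ count (induced T′)
    induced-gain₃ {c} {d} c∈T d∈T ac∈G a′d∈G = begin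
      count (induced T) + 3            ≡⟨ sym (+-assoc (count (induced T)) 2 1) ⟩
      count (induced T) + 2 + 1        ≡⟨ cong (_+ 1) (sym (count-two-new-edges c∈T)) ⟩
      count R + 1                      ≡⟨ sym (count-∪-edge R a′≢d R-sym a′d∉R) ⟩
      count (R ∪ᴱ edge a′ d)           ≤⟨ count-mono R′⊆T′ ⟩
      count (induced T′)               ∎
      where
      open ≤-Reasoning
      R = induced T ∪ᴱ edge a a′ ∪ᴱ edge a c
      a′≢d = ≢-sym (∈-∉-≢ T d∈T a′∉T)
      R-sym : Symmetricᴱ R
      R-sym = ∪ᴱ-sym (∪ᴱ-sym (induced-sym T) (edge-sym a a′)) (edge-sym a c)
      a′d∉R : ¬ R a′ d ≡ true
      a′d∉R = ∉-∪ᴱ (induced T ∪ᴱ edge a a′) (edge a c)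
        (∉-∪ᴱ (induced T) (edge a a′)
          (induced-∉ T d a′∉T) (edge-∉ʳ a′ (∈-∉-≢ T d∈T a∉T) (≢-sym a′≢d)))
        (edge-∉ˡ d (≢-sym (mate≢ a)) (≢-sym (∈-∉-≢ T c∈T a′∉T)))
      R′⊆T′ = ∪ᴱ-⊆ (∪ᴱ-⊆ (∪ᴱ-⊆ (induced-mono T⊆T′) aa′⊆T′)
                         (edge-⊆-T′ (∪-doubleton-∋ˡ T a a′) c∈T ac∈G))
                   (edge-⊆-T′ (∪-doubleton-∋ʳ T a a′) d∈T a′d∈G)

  ForcesOn : (Fin v → Bool) → Rel₂ v → Set
  ForcesOn T S =
    ∀ N → IsPerfectMatching G N → S ⊆ᴱ N → Closed N T → ∀ x y → T x ≡ true → N x y ≡ M x y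

  forcesOn-∪-pair : ∀ {T S S′ a} → T a ≡ false → T (mate a) ≡ false → ForcesOn T S → S ⊆ᴱ S′ →
    (∀ N → IsPerfectMatching G N → S′ ⊆ᴱ N → Closed N (T ∪ pair a) → N a (mate a) ≡ true) →
    ForcesOn (T ∪ pair a) S′
  forcesOn-∪-pair {T} {a = a} a∉T a′∉T T-forced S⊆S′ aa′-forced N N-pm S′⊆N N-closed x y x∈T′
    with aa′-forced N N-pm S′⊆N N-closed | ∪-doubleton⁻ T x∈T′
  ... | aa′∈N | inj₁ x∈T         = T-forced N N-pm (λ i j → S′⊆N i j ∘ S⊆S′ i j)
                                     (Matching.closed-∖-doubleton N-pm aa′∈N a∉T a′∉T N-closed) x y x∈T
  ... | aa′∈N | inj₂ (inj₁ refl) = Matching.row-agree N-pm M-pm aa′∈N (M-mate a) y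
  ... | aa′∈N | inj₂ (inj₂ refl) =
    Matching.row-agree N-pm M-pm (Matching.∈-sym N-pm aa′∈N) (∈-sym (M-mate a)) y

  DistinctNeighbours : (Fin v → Bool) → Fin v → Set
  DistinctNeighbours T a =
    ∃[ c ] ∃[ d ] (T c ≡ true × T d ≡ true × c ≢ d × adj G a c ≡ true × adj G (mate a) d ≡ true)

  distinctNeighbours? : ∀ T a → Dec (DistinctNeighbours T a)
  distinctNeighbours? T a = any? λ c → any? λ d →
    (T c ≟ᵇ true) ×-dec (T d ≟ᵇ true) ×-dec ¬? (c ≟ d) ×-dec
    (adj G a c ≟ᵇ true) ×-dec (adj G (mate a) d ≟ᵇ true)

  mate-forced : ∀ {T a} → T a ≡ false → T (mate a) ≡ false → ¬ DistinctNeighbours T a →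
    ∀ N → IsPerfectMatching G N → Closed N (T ∪ pair a) → N a (mate a) ≡ true
  mate-forced {T} {a} a∉T a′∉T no-neighbours N N-pm N-closed with N a (mate a) in aa′∉N
  ... | true  = refl
  ... | false = ⊥-elim (no-neighbours (c , d , c∈T , d∈T , c≢d , N.sub a c ac∈N , N.sub a′ d a′d∈N))
    where
    module N = Matching N-pm
    a′ = mate a
    c = N.partner a
    d = N.partner a′
    ac∈N = N.partner-∈ a
    a′d∈N = N.partner-∈ a′
    aa′∉N′ : ¬ N a a′ ≡ true
    aa′∉N′ aa′∈N with () ← trans (sym aa′∈N) aa′∉N
    c∈T : T c ≡ true
    c∈T = ∪-doubleton-∖ T (N-closed a c (∪-doubleton-∋ˡ T a a′) ac∈N) (≢-sym (N.loopless ac∈N))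
            (λ c≡a′ → aa′∉N′ (subst (λ z → N a z ≡ true) c≡a′ ac∈N))
    d∈T : T d ≡ true
    d∈T = ∪-doubleton-∖ T (N-closed a′ d (∪-doubleton-∋ʳ T a a′) a′d∈N)
            (λ d≡a → aa′∉N′ (N.∈-sym (subst (λ z → N a′ z ≡ true) d≡a a′d∈N)))
            (≢-sym (N.loopless a′d∈N))
    c≢d : c ≢ d
    c≢d c≡d = mate≢ a (N.unique c a a′ (N.∈-sym ac∈N)
                        (subst (λ z → N z a′ ≡ true) (sym c≡d) (N.∈-sym a′d∈N)))

  record Partial : Set where
    field
      T                : Fin v → Bool
      S                : Rel₂ v
      root             : Fin v
      root∈T           : T root ≡ true
      T-closed         : Closed M T
      S-sym            : Symmetricᴱ S
      S⊆M              : S ⊆ᴱ M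
      S-forces         : ForcesOn T S
      cyclomatic-bound : count S + size T ≤ count (induced T) + 1
      matching-bound   : 2 * count S + 2 ≤ size T

  record Step (st : Partial) (a : Fin v) : Set where
    open Partial st using (T; S)
    field
      S′        : Rel₂ v
      k         : ℕ
      k≤1       : k ≤ 1
      S′-sym    : Symmetricᴱ S′
      S′⊆M      : S′ ⊆ᴱ M
      S′-forces : ForcesOn (T ∪ pair a) S′
      S′-size   : count S′ ≤ count S + k
      gain      : count (induced T) + (k + 2) ≤ count (induced (T ∪ pair a))

  extended : (st : Partial) {a : Fin v} → Partial.T st a ≡ false → Step st a → Partial
  extended st {a} a∉T next = record
    { T                = T ∪ pair a
    ; S                = S′
    ; root             = root
    ; root∈T           = ∪-doubleton⁺ T a (mate a) root∈T
    ; T-closed         = closed-∪-doubleton (M-mate a) T-closed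
    ; S-sym            = S′-sym
    ; S⊆M              = S′⊆M
    ; S-forces         = S′-forces
    ; cyclomatic-bound = subst (λ t → count S′ + t ≤ count (induced (T ∪ pair a)) + 1) (sym size′)
                           (cyclomatic-step S′-size cyclomatic-bound gain)
    ; matching-bound   = subst (2 * count S′ + 2 ≤_) (sym size′) (matching-step S′-size k≤1 matching-bound)
    }
    where
    open Partial st
    open Step next
    size′ = size-∪-pair T-closed a∉T

  choose-step : (st : Partial) {x a : Fin v} →
    Partial.T st x ≡ true → Partial.T st a ≡ false → adj G x a ≡ true → Step st a
  choose-step st {x} {a} x∈T a∉T xa∈G with distinctNeighbours? (Partial.T st) a
  ... | no no-neighbours = record
    { S′        = S
    ; k         = 0
    ; k≤1       = z≤n
    ; S′-sym    = S-sym
    ; S′⊆M      = S⊆M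
    ; S′-forces = forcesOn-∪-pair a∉T a′∉T S-forces (λ _ _ ij∈S → ij∈S)
                    (λ N N-pm _ → mate-forced a∉T a′∉T no-neighbours N N-pm)
    ; S′-size   = m≤m+n (count S) 0
    ; gain      = induced-gain₂ a∉T a′∉T x∈T (trans (Graph.sym G a x) xa∈G)
    }
    where
    open Partial st
    a′∉T = closed-∉ T-closed (M-mate a) a∉T
  ... | yes (c , d , c∈T , d∈T , _ , ac∈G , a′d∈G) = record
    { S′        = S ∪ᴱ aa′
    ; k         = 1
    ; k≤1       = s≤s z≤n
    ; S′-sym    = ∪ᴱ-sym S-sym (edge-sym a (mate a))
    ; S′⊆M      = ∪ᴱ-⊆ S⊆M (edge-⊆ (M-mate a))
    ; S′-forces = forcesOn-∪-pair a∉T a′∉T S-forces (⊆-∪ᴱˡ S aa′)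
                    (λ N _ S′⊆N _ → S′⊆N a (mate a) (⊆-∪ᴱʳ S aa′ a (mate a) (edge-refl a (mate a))))
    ; S′-size   = ≤-trans (count-∪-≤ S aa′) (≤-reflexive (cong (count S +_) (count-edge (mate≢ a))))
    ; gain      = induced-gain₃ a∉T a′∉T c∈T d∈T ac∈G a′d∈G
    }
    where
    open Partial st
    aa′ = edge a (mate a)
    a′∉T = closed-∉ T-closed (M-mate a) a∉T

  initial : Fin v → Partial
  initial z = record
    { T                = T₀
    ; S                = ∅ᴱ
    ; root             = z
    ; root∈T           = ∪-doubleton-∋ˡ ∅ z (mate z)
    ; T-closed         = closed-∪-doubleton {T = ∅} (M-mate z) (λ _ _ ())
    ; S-sym            = λ _ _ → refl
    ; S⊆M              = λ _ _ ()
    ; S-forces         = forcesOn-∪-pair {T = ∅} {S = ∅ᴱ} refl refl (λ _ _ _ _ _ _ ()) (λ _ _ ())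
                           (λ N N-pm _ → mate-forced refl refl (λ { (_ , _ , () , _) }) N N-pm)
    ; cyclomatic-bound = cyclomatic
    ; matching-bound   = matching
    }
    where
    T₀ = ∅ ∪ pair z
    size-T₀ : size T₀ ≡ 2
    size-T₀ = trans (size-∪-pair (λ _ _ ()) refl) (cong (_+ 2) (countᵇ-false (λ _ → refl) (allFin v)))
    one-edge : 1 ≤ count (induced T₀)
    one-edge = subst (_≤ count (induced T₀)) (count-edge (mate≢ z)) (count-mono
      (edge-⊆-induced T₀ (∪-doubleton-∋ˡ ∅ z (mate z)) (∪-doubleton-∋ʳ ∅ z (mate z))
                         (sub z (mate z) (M-mate z))))
    cyclomatic : count (∅ᴱ {v}) + size T₀ ≤ count (induced T₀) + 1
    cyclomatic rewrite count-∅ᴱ {v} | size-T₀ = +-monoˡ-≤ 1 one-edge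
    matching : 2 * count (∅ᴱ {v}) + 2 ≤ size T₀
    matching rewrite count-∅ᴱ {v} | size-T₀ = ≤-refl

  Spanning : Partial → Set
  Spanning st = ∀ x → Partial.T st x ≡ true

  grow : Connected G → (fuel : ℕ) (st : Partial) → v ≤ size (Partial.T st) + fuel → Σ Partial Spanning
  grow conn fuel st v≤ with any? (λ y → Partial.T st y ≟ᵇ false)
  ... | no nothing-missing = st , λ y → ¬-not (nothing-missing ∘ (y ,_))
  grow conn zero st v≤ | yes (y , y∉T) =
    ⊥-elim (<⇒≱ (size-missing y∉T) (subst (v ≤_) (+-identityʳ _) v≤))
  grow conn (suc fuel) st v≤ | yes (y , y∉T)
    with boundary-edge (Partial.T st) (conn (Partial.root st) y) (Partial.root∈T st) y∉T
  ... | x , a , x∈T , a∉T , xa∈G =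
    grow conn fuel (extended st a∉T (choose-step st x∈T a∉T xa∈G))
      (subst (λ t → v ≤ t + fuel) (sym (size-∪-pair (Partial.T-closed st) a∉T))
        (≤-trans v≤ (≤-trans (+-monoʳ-≤ t (n≤1+n (suc fuel))) (≤-reflexive (sym (+-assoc t 2 fuel))))))
    where t = size (Partial.T st)

  forcing-set-bound : Connected G → Fin v →
    ∃[ S ] (IsForcingSet G M S × count S + v ≤ e G + 1 × 2 * count S + 2 ≤ v)
  forcing-set-bound conn z with grow conn v (initial z) (m≤n+m v _)
  ... | st , spanning = S , forcing , cyclomatic , matching
    where
    open Partial st
    size-T : size T ≡ v
    size-T = size-full spanning
    forcing : IsForcingSet G M S
    forcing = record
      { ssym   = S-sym
      ; ⊆M     = S⊆M
      ; forces = λ N N-pm S⊆N x y → S-forces N N-pm S⊆N (λ _ y _ _ → spanning y) x y (spanning x)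
      }
    cyclomatic : count S + v ≤ e G + 1
    cyclomatic = subst (λ t → count S + t ≤ e G + 1) size-T
      (≤-trans cyclomatic-bound (+-monoˡ-≤ 1 (count-mono (induced-⊆-adj T))))
    matching : 2 * count S + 2 ≤ v
    matching = subst (2 * count S + 2 ≤_) size-T matching-bound

-- The bound (e(G) − n)/2 is the average of the two bounds of forcing-set-bound, so neither case
-- hypothesis is needed.
corollary3p1 : (n : ℕ) (G : Graph (2 * n)) → Connected G → HasPerfectMatching G →
    (3 * n ≤ e G + 2 →
      ∀ M → IsPerfectMatching G M →
        ∃[ S ] (IsForcingSet G M S × 2 * count S + n ≤ e G)) ×
    (e G + 2 < 3 * n →
      ∀ M → IsPerfectMatching G M →
        ∃[ S ] (IsForcingSet G M S × count S + 2 * n ≤ e G + 1))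
corollary3p1 zero G _ _ =
  (λ _ M _ → ∅ᴱ , ∅ᴱ-forcing M , z≤n) , (λ _ M _ → ∅ᴱ , ∅ᴱ-forcing M , z≤n)
  where
  ∅ᴱ-forcing : ∀ M → IsForcingSet G M ∅ᴱ
  ∅ᴱ-forcing M = record { ssym = λ _ _ → refl ; ⊆M = λ _ _ () ; forces = λ _ _ _ () }
corollary3p1 n@(suc _) G conn _ =
    (λ _ M M-pm → let S , forcing , cyclomatic , matching = bound M M-pm
                  in  S , forcing , average-bound {count S} {n} {e G} cyclomatic matching)
  , (λ _ M M-pm → let S , forcing , cyclomatic , _ = bound M M-pm in S , forcing , cyclomatic)
  where
  bound : ∀ M → IsPerfectMatching G M →
    ∃[ S ] (IsForcingSet G M S × count S + 2 * n ≤ e G + 1 × 2 * count S + 2 ≤ 2 * n)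
  bound M M-pm = Growth.forcing-set-bound G M M-pm conn zero
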